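{- Let $G=(V,E)$ be a simple directed graph with $n$ vertices and $m$ edges, let $\epsilon>0$, and let $\Delta=\min\big(n/(1+\epsilon),\,(m/(1+\epsilon))^{1/2}\big)$. If $\kappa_G\ge\Delta$, then $d^{\mathrm{out}}_{\min}\le(1+\epsilon)\kappa_G$.
   Context: $d^{\mathrm{out}}_{\min}$ is the minimum out-degree of a vertex of $G$. $\kappa_G$ is the vertex connectivity: the minimum size of a set $U\subseteq V$ such that $G\setminus U$ is not strongly connected, or $n-1$ if no such set exists. (In particular $\kappa_G\le d^{\mathrm{out}}_{\min}$.)
   Formalization: The parameter ε ranges over the positive rationals. -}

module Defs where

open import Data.Nat using (ℕ; _∸_; _≤_)
open import Data.Bool using (Bool; false; true)
open import Data.Fin using (Fin)
open import Data.Fin.Subset using (Subset; _∈_; _∉_; ∣_∣)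
open import Data.Vec using (tabulate; sum)
open import Data.Product using (Σ; ∃; _×_)
open import Data.Sum using (_⊎_)
open import Data.Integer using (+_)
open import Data.Rational using (ℚ; _/_)
open import Relation.Nullary using (¬_)
open import Relation.Binary.PropositionalEquality using (_≡_)

-- A simple directed graph on vertex set Fin n: adjacency relation
-- (E u v ≡ true means there is an edge u → v), with no loops.
-- Multiple edges are impossible by construction.
record SimpleDigraph (n : ℕ) : Set where
  field
    adj    : Fin n → Fin n → Bool
    noLoop : ∀ v → adj v v ≡ false
open SimpleDigraph public

outNbhd : ∀ {n} → SimpleDigraph n → Fin n → Subset n
outNbhd G v = tabulate (adj G v)

outDeg : ∀ {n} → SimpleDigraph n → Fin n → ℕ
outDeg G v = ∣ outNbhd G v ∣

numEdges : ∀ {n} → SimpleDigraph n → ℕ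
numEdges G = sum (tabulate (outDeg G))

IsMinOutDeg : ∀ {n} → SimpleDigraph n → ℕ → Set
IsMinOutDeg G d = (∃ λ v → outDeg G v ≡ d) × (∀ v → d ≤ outDeg G v)

data ReachAvoid {n} (G : SimpleDigraph n) (U : Subset n) : Fin n → Fin n → Set where
  here : ∀ {u} → u ∉ U → ReachAvoid G U u u
  step : ∀ {u w v} → u ∉ U → adj G u w ≡ true → ReachAvoid G U w v → ReachAvoid G U u v

StronglyConnectedMinus : ∀ {n} → SimpleDigraph n → Subset n → Set
StronglyConnectedMinus G U = ∀ u v → u ∉ U → v ∉ U → ReachAvoid G U u v

IsConnectivity : ∀ {n} → SimpleDigraph n → ℕ → Set
IsConnectivity {n} G k =
  (Σ (Subset n) λ U → ∣ U ∣ ≡ k × ¬ StronglyConnectedMinus G U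
      × (∀ U' → ¬ StronglyConnectedMinus G U' → k ≤ ∣ U' ∣))
  ⊎ ((∀ U → StronglyConnectedMinus G U) × k ≡ n ∸ 1)

ℕ→ℚ : ℕ → ℚ
ℕ→ℚ k = + k / 1

module Submission where

-- Write c = 1 + ε, d for the minimum out-degree, m for the
-- number of edges and κ for the connectivity.  Two counting facts suffice:
--   (a) d ≤ n, and more generally d · k ≤ n · d ≤ m for every k ≤ n,
--       since each of the n vertices has out-degree at least d;
--   (b) κ ≤ n, because κ is the size of a vertex subset or equals n ∸ 1.
-- If n ≤ c·κ, then d ≤ n ≤ c·κ by (a).  If m ≤ c·κ², then by (a) and (b)
-- d · κ ≤ m ≤ c·κ·κ, and cancelling κ gives d ≤ c·κ when κ > 0; when
-- κ = 0 the hypothesis says m = 0, and d ≤ m because d is itself the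
-- out-degree of some vertex, i.e. one summand of m.

open import Defs
open import Data.Nat using (ℕ)
open import Data.Sum using (_⊎_)
open import Data.Rational using (ℚ; _+_; _*_; _≤_; Positive; 1ℚ)

import Data.Nat as ℕ
import Data.Nat.Properties as ℕ
import Data.Integer as ℤ
import Data.Integer.Properties as ℤ
import Data.Rational as ℚ
import Data.Rational.Properties as ℚ
import Data.Nat.Coprimality as Coprimality
open import Data.Fin using (Fin; zero; suc)
open import Data.Fin.Subset.Properties using (∣p∣≤n)
open import Data.Vec using (tabulate; sum)
open import Data.Product using (_,_)
open import Data.Sum using (inj₁; inj₂)
open import Relation.Binary.PropositionalEquality
  using (_≡_; sym; cong; subst; subst₂)

-- ℕ→ℚ k = k / 1 is already in lowest terms, so it is the normal form mkℚ k 0.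
ℕ→ℚ-normal : ∀ k → ℕ→ℚ k ≡ ℚ.mkℚ (ℤ.+ k) 0 (Coprimality.sym (Coprimality.1-coprimeTo k))
ℕ→ℚ-normal k = ℚ.normalize-coprime {k} {0} (Coprimality.sym (Coprimality.1-coprimeTo k))

ℕ→ℚ-mono-≤ : ∀ {a b} → a ℕ.≤ b → ℕ→ℚ a ≤ ℕ→ℚ b
ℕ→ℚ-mono-≤ {a} {b} a≤b rewrite ℕ→ℚ-normal a | ℕ→ℚ-normal b =
  ℚ.*≤* (subst₂ ℤ._≤_ (sym (ℤ.*-identityʳ (ℤ.+ a))) (sym (ℤ.*-identityʳ (ℤ.+ b)))
                      (ℤ.+≤+ a≤b))

ℕ→ℚ-homo-* : ∀ a b → ℕ→ℚ (a ℕ.* b) ≡ ℕ→ℚ a * ℕ→ℚ b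
ℕ→ℚ-homo-* a b rewrite ℕ→ℚ-normal a | ℕ→ℚ-normal b =
  sym (cong (ℚ._/ 1) (ℤ.+◃n≡+n (a ℕ.* b)))

ℕ→ℚ-suc-positive : ∀ k → Positive (ℕ→ℚ (ℕ.suc k))
ℕ→ℚ-suc-positive k rewrite ℕ→ℚ-normal (ℕ.suc k) = _

cancel-square : ∀ p c r → .{{_ : Positive r}} → p * r ≤ c * (r * r) → p ≤ c * r
cancel-square p c r pr≤crr =
  ℚ.*-cancelʳ-≤-pos r (subst (p * r ≤_) (sym (ℚ.*-assoc c r r)) pr≤crr)

summand≤sum : ∀ {n} (f : Fin n → ℕ) i → f i ℕ.≤ sum (tabulate f)
summand≤sum f zero    = ℕ.m≤m+n (f zero) _
summand≤sum f (suc i) =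
  ℕ.≤-trans (summand≤sum (λ j → f (suc j)) i) (ℕ.m≤n+m _ (f zero))

sum≥count*lower : ∀ {n} (f : Fin n → ℕ) d → (∀ i → d ℕ.≤ f i) →
                  n ℕ.* d ℕ.≤ sum (tabulate f)
sum≥count*lower {ℕ.zero}  f d f≥d = ℕ.z≤n
sum≥count*lower {ℕ.suc n} f d f≥d =
  ℕ.+-mono-≤ (f≥d zero) (sum≥count*lower (λ i → f (suc i)) d (λ i → f≥d (suc i)))

minOutDeg≤vertices : ∀ {n} (G : SimpleDigraph n) {d} → IsMinOutDeg G d → d ℕ.≤ n
minOutDeg≤vertices G ((v , deg-v≡d) , _) =
  subst (ℕ._≤ _) deg-v≡d (∣p∣≤n (outNbhd G v))

minOutDeg≤edges : ∀ {n} (G : SimpleDigraph n) {d} → IsMinOutDeg G d → d ℕ.≤ numEdges G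
minOutDeg≤edges G ((v , deg-v≡d) , _) =
  subst (ℕ._≤ numEdges G) deg-v≡d (summand≤sum (outDeg G) v)

minOutDeg*≤edges : ∀ {n} (G : SimpleDigraph n) {d k} → IsMinOutDeg G d →
                   k ℕ.≤ n → d ℕ.* k ℕ.≤ numEdges G
minOutDeg*≤edges {n} G {d} (_ , d≤deg) k≤n = ℕ.≤-trans (ℕ.*-monoʳ-≤ d k≤n)
  (subst (ℕ._≤ numEdges G) (ℕ.*-comm n d) (sum≥count*lower (outDeg G) d d≤deg))

connectivity≤vertices : ∀ {n} (G : SimpleDigraph n) {κ} → IsConnectivity G κ → κ ℕ.≤ n
connectivity≤vertices G (inj₁ (U , ∣U∣≡κ , _)) = subst (ℕ._≤ _) ∣U∣≡κ (∣p∣≤n U)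
connectivity≤vertices {n} G (inj₂ (_ , κ≡n∸1)) = subst (ℕ._≤ n) (sym κ≡n∸1) (ℕ.m∸n≤m n 1)

proposition5p4 : ∀ {n} (G : SimpleDigraph n) (ε : ℚ) → Positive ε →
    (κ d : ℕ) → IsConnectivity G κ → IsMinOutDeg G d →
    (ℕ→ℚ n ≤ (1ℚ + ε) * ℕ→ℚ κ ⊎ ℕ→ℚ (numEdges G) ≤ (1ℚ + ε) * (ℕ→ℚ κ * ℕ→ℚ κ)) →
    ℕ→ℚ d ≤ (1ℚ + ε) * ℕ→ℚ κ
-- Case n ≤ c·κ:  d ≤ n ≤ c·κ.
proposition5p4 G ε _ κ d conn minDeg (inj₁ n≤cκ) =
  ℚ.≤-trans (ℕ→ℚ-mono-≤ (minOutDeg≤vertices G minDeg)) n≤cκ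
proposition5p4 G ε _ ℕ.zero d conn minDeg (inj₂ m≤0) =
  ℚ.≤-trans (ℕ→ℚ-mono-≤ (minOutDeg≤edges G minDeg)) m≤0
proposition5p4 G ε _ κ@(ℕ.suc k) d conn minDeg (inj₂ m≤cκ²) =
  cancel-square (ℕ→ℚ d) (1ℚ + ε) (ℕ→ℚ κ) {{ℕ→ℚ-suc-positive k}} dκ≤cκ²
  where
  dκ≤m : d ℕ.* κ ℕ.≤ numEdges G
  dκ≤m = minOutDeg*≤edges G minDeg (connectivity≤vertices G conn)

  dκ≤cκ² : ℕ→ℚ d * ℕ→ℚ κ ≤ (1ℚ + ε) * (ℕ→ℚ κ * ℕ→ℚ κ)
  dκ≤cκ² = subst (_≤ _) (ℕ→ℚ-homo-* d κ) (ℚ.≤-trans (ℕ→ℚ-mono-≤ dκ≤m) m≤cκ²)
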